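{- The deterministic $\mathsf{LimSup}$-automata over infinite words are closed under sum, with cost $O(n_1\cdot n_2\cdot 2^{m_1\cdot m_2})$.
   Context: A weighted automaton is $A=(Q,q_I,\Sigma,\delta,\gamma)$ with finite state set $Q$, initial state $q_I$, finite alphabet $\Sigma$, total transition relation $\delta\subseteq Q\times\Sigma\times Q$, and weights $\gamma:\delta\to\mathbb{Q}$; deterministic if for all $q,\sigma$ exactly one $q'$ with $(q,\sigma,q')\in\delta$. The run over $w=\sigma_1\sigma_2\dots\in\Sigma^\omega$ is $q_0\sigma_1q_1\dots$ with $q_0=q_I$, $(q_i,\sigma_{i+1},q_{i+1})\in\delta$, weight sequence $v_i=\gamma(q_i,\sigma_{i+1},q_{i+1})$. A $\mathsf{LimSup}$-automaton defines $L_A(w)=\sup$ over runs of $\limsup_nv_n$. $(L_1+L_2)(w)=L_1(w)+L_2(w)$. A class $\mathcal{C}$ is closed under sum with cost at most $O(f(n_1,m_1,n_2,m_2))$ if for all $A_1,A_2\in\mathcal{C}$, with $A_i$ having $n_i$ states and $m_i$ transitions, one can construct $A_{12}\in\mathcal{C}$ with $L_{A_{12}}=L_{A_1}+L_{A_2}$ and $O(f(n_1,m_1,n_2,m_2))$ states. -}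

module Defs where

open import Data.Nat using (ℕ; zero; suc; _*_; _≤_)
open import Data.Fin using (Fin)
open import Data.Rational using (ℚ; 0ℚ; _<_; _+_; _-_)
open import Data.Product using (_×_; ∃-syntax)

Word : ℕ → Set
Word s = ℕ → Fin s

-- Q = Fin states, initial state init; since the automaton is deterministic and
-- total, the transition relation is the graph of δ, and γ assigns a rational
-- weight to every transition (q , σ , δ q σ).
record DetAut (s : ℕ) : Set where
  field
    states : ℕ
    init   : Fin states
    δ      : Fin states → Fin s → Fin states
    γ      : Fin states → Fin s → ℚ

open DetAut public

transitions : ∀ {s} → DetAut s → ℕ
transitions {s} A = states A * s

run : ∀ {s} (A : DetAut s) → Word s → ℕ → Fin (states A)
run A w zero    = init A
run A w (suc i) = δ A (run A w i) (w i)

-- weight sequence v_i = γ(q_i, σ_{i+1}, q_{i+1})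
weights : ∀ {s} (A : DetAut s) → Word s → ℕ → ℚ
weights A w i = γ A (run A w i) (w i)

IsLimSup : (ℕ → ℚ) → ℚ → Set
IsLimSup v x =
  (∀ ε → 0ℚ < ε → ∃[ N ] (∀ k → N ≤ k → v k < x + ε)) ×
  (∀ ε → 0ℚ < ε → ∀ N → ∃[ k ] (N ≤ k × x - ε < v k))

-- L_A(w) = x  (deterministic: exactly one run, so the sup over runs is that run's limsup)
LimSupValue : ∀ {s} → DetAut s → Word s → ℚ → Set
LimSupValue A w x = IsLimSup (weights A w) x

module Submission where

open import Defs
open import Data.Nat using (ℕ; _*_; _^_; _≤_)
open import Data.Rational using (_+_)
open import Data.Product using (_×_; ∃-syntax)

-- Write a = v₁ and b = v₂ for the weight sequences of A₁ and A₂ on a word w.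
-- The sum automaton emits, at step n,
--     a n + max { b j | r < j ≤ n },
-- where r < n is the last step with a r ≥ a n (r = -1 if there is none).
-- If limsup a = x₁ is attained (a ≤ x₁ eventually and a ≥ x₁ infinitely
-- often, which holds since a ranges over the finitely many weights of A₁),
-- this sequence has limsup x₁ + x₂: late steps with a n ≤ x₁ see a window
-- that starts after a late visit of x₁, so it only contains late b's; and a
-- late large b k is caught by the first step n ≥ k with a n ≥ x₁.
--
-- The state space is
-- Q₁ × Q₂ × (Fin (1 + m₂))^m₁, encoded into Fin (n₁ · n₂ · (1 + m₂)^m₁),
-- which is at most n₁ · n₂ · 2^(m₁ · m₂).

open import Data.Nat as ℕ using (zero; suc; s≤s; z≤n)
import Data.Nat.Properties as ℕP
open import Data.Fin using (Fin; zero; suc; combine; remQuot; funToFin; finToFun)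
open import Data.Fin.Properties using (remQuot-combine; finToFun-funToFin; *↔×)
open import Data.Vec using (Vec; lookup; tabulate; replicate)
open import Data.Vec.Properties using (lookup∘tabulate; tabulate∘lookup; tabulate-cong; lookup-replicate)
open import Data.Maybe using (Maybe; nothing; just)
open import Data.Product using (_,_; proj₁; proj₂; uncurry)
open import Data.Product.Function.NonDependent.Propositional using (_×-↩_)
open import Data.Sum using (inj₁; inj₂)
open import Data.Rational as Q using (ℚ; 0ℚ; 1ℚ; _-_; -_)
import Data.Rational.Properties as QP
open import Data.Rational.Solver using (module +-*-Solver)
open +-*-Solver using (solve; _:+_; _:-_; _:=_)
open import Function using (_∘_; _↩_; mk↩; LeftInverse)
open import Function.Consequences.Propositional using (strictlyInverseˡ⇒inverseˡ)
open import Function.Construct.Composition using (_↩-∘_)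
open import Function.Construct.Identity using (↩-id)
open import Function.Properties.Inverse using (↔⇒↩)
open import Relation.Nullary using (¬_; yes; no; contradiction)
open import Relation.Unary using (Decidable)
open import Relation.Binary.Definitions using (tri<; tri≈; tri>)
open import Relation.Binary.PropositionalEquality

_⊔ₘ_ : Maybe ℚ → ℚ → ℚ
nothing ⊔ₘ v = v
just x  ⊔ₘ v = x Q.⊔ v

v≤m⊔ₘv : ∀ m v → v Q.≤ m ⊔ₘ v
v≤m⊔ₘv nothing  v = QP.≤-refl
v≤m⊔ₘv (just x) v = QP.p≤q⊔p x v

⊔-< : ∀ {x y c} → x Q.< c → y Q.< c → x Q.⊔ y Q.< c
⊔-< {x} {y} x<c y<c with QP.⊔-sel x y
... | inj₁ x⊔y≡x = subst (Q._< _) (sym x⊔y≡x) x<c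
... | inj₂ x⊔y≡y = subst (Q._< _) (sym x⊔y≡y) y<c

<⇒≱ : ∀ {x y} → x Q.< y → ¬ (y Q.≤ x)
<⇒≱ x<y y≤x = QP.<-irrefl refl (QP.<-≤-trans x<y y≤x)

keepBelow : ℚ → ℚ → ℚ → Maybe ℚ
keepBelow θ a x with θ Q.≤? a
... | yes _ = nothing
... | no  _ = just x

leastFrom : (P : ℕ → Set) → Decidable P → ∀ {k n} → k ≤ n → P n →
            ∃[ n₀ ] (k ≤ n₀ × P n₀ × (∀ p → k ≤ p → p ℕ.< n₀ → ¬ P p))
leastFrom P P? {k} {n} k≤n Pn = scan (n ℕ.∸ k) k (subst P (sym (ℕP.m∸n+n≡m k≤n)) Pn)
  where
  scan : ∀ d k → P (d ℕ.+ k) →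
         ∃[ n₀ ] (k ≤ n₀ × P n₀ × (∀ p → k ≤ p → p ℕ.< n₀ → ¬ P p))
  scan zero    k Pk = k , ℕP.≤-refl , Pk , λ p k≤p p<k _ → ℕP.≤⇒≯ k≤p p<k
  scan (suc d) k Pd+k with P? k
  ... | yes Pk = k , ℕP.≤-refl , Pk , λ p k≤p p<k _ → ℕP.≤⇒≯ k≤p p<k
  ... | no ¬Pk with scan d (suc k) (subst P (sym (ℕP.+-suc d k)) Pd+k)
  ...   | n₀ , k<n₀ , Pn₀ , below = n₀ , ℕP.<⇒≤ k<n₀ , Pn₀ , below′
    where
    below′ : ∀ p → k ≤ p → p ℕ.< n₀ → ¬ P p
    below′ p k≤p p<n₀ with ℕP.m≤n⇒m<n∨m≡n k≤p
    ... | inj₁ k<p  = below p k<p p<n₀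
    ... | inj₂ refl = ¬Pk

-- The limit superior x of v is attained: eventually v ≤ x, and v ≥ x
-- infinitely often.  This is what finite-valued sequences satisfy.
LimSupAttained : (ℕ → ℚ) → ℚ → Set
LimSupAttained v x = (∃[ N ] (∀ k → N ≤ k → v k Q.≤ x)) × (∀ N → ∃[ k ] (N ≤ k × x Q.≤ v k))

IsLimSup-cong : ∀ {u v x} → (∀ n → u n ≡ v n) → IsLimSup v x → IsLimSup u x
IsLimSup-cong {u} {v} {x} u≗v (upper , lower) =
  (λ ε ε>0 → let (N , v<) = upper ε ε>0 in
     N , λ k N≤k → subst (Q._< x + ε) (sym (u≗v k)) (v< k N≤k)) ,
  (λ ε ε>0 N → let (k , N≤k , <v) = lower ε ε>0 N in
     k , N≤k , subst (x - ε Q.<_) (sym (u≗v k)) <v)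

-- The running-maximum window of a pair of sequences

module Window (a b : ℕ → ℚ) where

  -- runningMax θ n is the maximum of b j over r < j < n, where r < n is the
  -- last index with θ ≤ a r (all j < n if there is none); nothing if empty.
  runningMax : ℚ → ℕ → Maybe ℚ
  runningMax θ zero    = nothing
  runningMax θ (suc n) = keepBelow θ (a n) (runningMax θ n ⊔ₘ b n)

  window : ℚ → ℕ → ℚ
  window θ n = runningMax θ n ⊔ₘ b n

  window-bounded : ∀ {θ c} k n → k ℕ.< n → θ Q.≤ a k →
                   (∀ j → k ℕ.< j → j ≤ n → b j Q.< c) → window θ n Q.< c
  window-bounded {θ} k (suc n) k<1+n θ≤ak b<c with θ Q.≤? a n
  ... | yes _ = b<c (suc n) k<1+n ℕP.≤-refl
  ... | no θ≰an =
    ⊔-< (window-bounded k n k<n θ≤ak (λ j k<j j≤n → b<c j k<j (ℕP.m≤n⇒m≤1+n j≤n)))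
        (b<c (suc n) k<1+n ℕP.≤-refl)
    where
    k<n : k ℕ.< n
    k<n with ℕP.m≤n⇒m<n∨m≡n (ℕP.≤-pred k<1+n)
    ... | inj₁ k<n  = k<n
    ... | inj₂ refl = contradiction θ≤ak θ≰an

  window-dominates : ∀ {θ} k n → k ≤ n →
                     (∀ p → k ≤ p → p ℕ.< n → a p Q.< θ) → b k Q.≤ window θ n
  window-dominates {θ} k n k≤n a<θ with ℕP.m≤n⇒m<n∨m≡n k≤n
  ... | inj₂ refl = v≤m⊔ₘv (runningMax θ k) (b k)
  ... | inj₁ (s≤s {n = n′} k≤n′) with θ Q.≤? a n′
  ...   | yes θ≤an′ = contradiction θ≤an′ (<⇒≱ (a<θ n′ k≤n′ ℕP.≤-refl))
  ...   | no _ =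
    QP.≤-trans (window-dominates k n′ k≤n′ (λ p k≤p p<n′ → a<θ p k≤p (ℕP.m<n⇒m<1+n p<n′)))
               (QP.p≤p⊔q (window θ n′) (b n))

  sumSeq : ℕ → ℚ
  sumSeq n = a n + window (a n) n

  sumSeq-limsup : ∀ {x₁ x₂} → LimSupAttained a x₁ → IsLimSup b x₂ → IsLimSup sumSeq (x₁ + x₂)
  sumSeq-limsup {x₁} {x₂} ((N₁ , a≤x₁) , often-above) (b-upper , b-lower) = upper , lower
    where
    upper : ∀ ε → 0ℚ Q.< ε → ∃[ N ] (∀ n → N ≤ n → sumSeq n Q.< (x₁ + x₂) + ε)
    upper ε ε>0 with b-upper ε ε>0
    ... | N₂ , b<x₂+ε with often-above (N₁ ℕ.+ N₂)
    ...   | K , N₁+N₂≤K , x₁≤aK = suc K , bound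
      where
      late : ∀ N n → N ≤ N₁ ℕ.+ N₂ → K ℕ.< n → N ≤ n
      late N n N≤ K<n = ℕP.≤-trans N≤ (ℕP.≤-trans N₁+N₂≤K (ℕP.<⇒≤ K<n))
      bound : ∀ n → suc K ≤ n → sumSeq n Q.< (x₁ + x₂) + ε
      bound n K<n = subst (sumSeq n Q.<_) (sym (QP.+-assoc x₁ x₂ ε))
        (QP.+-mono-≤-< an≤x₁
          (window-bounded K n K<n (QP.≤-trans an≤x₁ x₁≤aK)
            (λ j K<j _ → b<x₂+ε j (late N₂ j (ℕP.m≤n+m N₂ N₁) K<j))))
        where
        an≤x₁ : a n Q.≤ x₁
        an≤x₁ = a≤x₁ n (late N₁ n (ℕP.m≤m+n N₁ N₂) K<n)

    lower : ∀ ε → 0ℚ Q.< ε → ∀ N → ∃[ n ] (N ≤ n × (x₁ + x₂) - ε Q.< sumSeq n)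
    lower ε ε>0 N with b-lower ε ε>0 N
    ... | k , N≤k , b-high with often-above k
    ...   | n , k≤n , x₁≤an with leastFrom (λ p → x₁ Q.≤ a p) (λ p → x₁ Q.≤? a p) k≤n x₁≤an
    ...     | n₀ , k≤n₀ , x₁≤an₀ , before = n₀ , ℕP.≤-trans N≤k k≤n₀ ,
      subst (Q._< sumSeq n₀) (sym (QP.+-assoc x₁ x₂ (- ε)))
        (QP.+-mono-≤-< x₁≤an₀
          (QP.<-≤-trans b-high
            (window-dominates k n₀ k≤n₀
              (λ p k≤p p<n₀ → QP.<-≤-trans (QP.≰⇒> (before p k≤p p<n₀)) x₁≤an₀))))

-- Finite-valued sequences attain their limit superior

Isolated : ℚ → ℚ → ℚ → Set
Isolated x g v = (v Q.< x + g → v Q.≤ x) × (x - g Q.< v → x Q.≤ v)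

isolated-mono : ∀ {x g g′ v} → g′ Q.≤ g → Isolated x g v → Isolated x g′ v
isolated-mono {x} g′≤g (below , above) =
  (λ v<x+g′ → below (QP.<-≤-trans v<x+g′ (QP.+-monoʳ-≤ x g′≤g))) ,
  (λ x-g′<v → above (QP.≤-<-trans (QP.+-monoʳ-≤ x (QP.neg-antimono-≤ g′≤g)) x-g′<v))

difference-pos : ∀ {x y} → x Q.< y → 0ℚ Q.< y - x
difference-pos {x} {y} x<y = subst (Q._< y - x) (QP.+-inverseʳ x) (QP.+-monoˡ-< (- x) x<y)

isolated-single : ∀ x v → ∃[ g ] (0ℚ Q.< g × Isolated x g v)
isolated-single x v with QP.<-cmp x v
... | tri< x<v _ _ = v - x , difference-pos x<v ,
      (λ v<x+g → contradiction (subst (v Q.<_) (x+[v-x]≡v x v) v<x+g) (QP.<-irrefl refl)) ,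
      (λ _ → QP.<⇒≤ x<v)
  where
  x+[v-x]≡v : ∀ x v → x + (v - x) ≡ v
  x+[v-x]≡v = solve 2 (λ x v → x :+ (v :- x) := v) refl
... | tri≈ _ refl _ = 1ℚ , QP.positive⁻¹ 1ℚ , (λ _ → QP.≤-refl) , (λ _ → QP.≤-refl)
... | tri> _ _ v<x = x - v , difference-pos v<x , (λ _ → QP.<⇒≤ v<x) ,
      (λ x-g<v → contradiction (subst (Q._< v) (x-[x-v]≡v x v) x-g<v) (QP.<-irrefl refl))
  where
  x-[x-v]≡v : ∀ x v → x - (x - v) ≡ v
  x-[x-v]≡v = solve 2 (λ x v → x :- (x :- v) := v) refl

isolating-gap : ∀ {m} (f : Fin m → ℚ) x → ∃[ g ] (0ℚ Q.< g × (∀ i → Isolated x g (f i)))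
isolating-gap {zero}  f x = 1ℚ , QP.positive⁻¹ 1ℚ , λ ()
isolating-gap {suc m} f x with isolated-single x (f zero) | isolating-gap (f ∘ suc) x
... | g₀ , g₀>0 , iso₀ | g₁ , g₁>0 , iso₁ = g₀ Q.⊓ g₁ , min-pos , iso
  where
  min-pos : 0ℚ Q.< g₀ Q.⊓ g₁
  min-pos with QP.⊓-sel g₀ g₁
  ... | inj₁ eq = subst (0ℚ Q.<_) (sym eq) g₀>0
  ... | inj₂ eq = subst (0ℚ Q.<_) (sym eq) g₁>0
  iso : ∀ i → Isolated x (g₀ Q.⊓ g₁) (f i)
  iso zero    = isolated-mono (QP.p⊓q≤p g₀ g₁) iso₀
  iso (suc i) = isolated-mono (QP.p⊓q≤q g₀ g₁) (iso₁ i)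

finite-range-attained : ∀ {m v x} (f : Fin m → ℚ) → (∀ k → ∃[ i ] v k ≡ f i) →
                        IsLimSup v x → LimSupAttained v x
finite-range-attained {v = v} {x} f range (upper , lower) with isolating-gap f x
... | g , g>0 , iso = eventually-below , often-above
  where
  iso-v : ∀ k → Isolated x g (v k)
  iso-v k with range k
  ... | i , vk≡fi = subst (Isolated x g) (sym vk≡fi) (iso i)
  eventually-below : ∃[ N ] (∀ k → N ≤ k → v k Q.≤ x)
  eventually-below with upper g g>0
  ... | N , v<x+g = N , λ k N≤k → proj₁ (iso-v k) (v<x+g k N≤k)
  often-above : ∀ N → ∃[ k ] (N ≤ k × x Q.≤ v k)
  often-above N with lower g g>0 N
  ... | k , N≤k , x-g<vk = k , N≤k , proj₂ (iso-v k) x-g<vk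

record Machine (s : ℕ) (S : Set) : Set where
  field
    start : S
    next  : S → Fin s → S
    out   : S → Fin s → ℚ

open Machine

trace : ∀ {s S} → Machine s S → Word s → ℕ → S
trace M w zero    = start M
trace M w (suc n) = next M (trace M w n) (w n)

outputs : ∀ {s S} → Machine s S → Word s → ℕ → ℚ
outputs M w n = out M (trace M w n) (w n)

-- A code Fin N ↩ S (decoding `to`, encoding `from`, with to ∘ from = id)
-- turns a machine into a DetAut with N states: it runs on codes and
-- decodes the current code before each step.
module _ {s N} {S : Set} (code : Fin N ↩ S) (M : Machine s S) where

  open LeftInverse code

  realise : DetAut s
  realise = record
    { states = N
    ; init   = from (start M)
    ; δ      = λ i σ → from (next M (to i) σ)
    ; γ      = λ i σ → out M (to i) σ
    }

  realise-run : ∀ w n → to (run realise w n) ≡ trace M w n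
  realise-run w zero    = strictlyInverseˡ (start M)
  realise-run w (suc n) =
    trans (strictlyInverseˡ (next M _ (w n))) (cong (λ q → next M q (w n)) (realise-run w n))

  realise-weights : ∀ w n → weights realise w n ≡ outputs M w n
  realise-weights w n = cong (λ q → out M q (w n)) (realise-run w n)

vecCode : ∀ {k m} → Fin (k ^ m) ↩ Vec (Fin k) m
vecCode = mk↩ (strictlyInverseˡ⇒inverseˡ (tabulate ∘ finToFun) tabulate-funToFin)
  where
  tabulate-funToFin : ∀ {k m} (v : Vec (Fin k) m) → tabulate (finToFun (funToFin (lookup v))) ≡ v
  tabulate-funToFin v = trans (tabulate-cong (finToFun-funToFin (lookup v))) (tabulate∘lookup v)

pairCode : ∀ {n N} {S : Set} → Fin N ↩ S → Fin (n * N) ↩ (Fin n × S)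
pairCode {n} {N} code = (↩-id (Fin n) ×-↩ code) ↩-∘ ↔⇒↩ (*↔× {n} {N})

transitionOf : ∀ {s} (A : DetAut s) → Fin (states A) → Fin s → Fin (transitions A)
transitionOf A = combine

transitionWeight : ∀ {s} (A : DetAut s) → Fin (transitions A) → ℚ
transitionWeight {s} A t = uncurry (γ A) (remQuot s t)

transitionWeight-of : ∀ {s} (A : DetAut s) q σ → transitionWeight A (transitionOf A q σ) ≡ γ A q σ
transitionWeight-of {s} A q σ = cong (uncurry (γ A)) (remQuot-combine q σ)

weights-finite-range : ∀ {s} (A : DetAut s) w k → ∃[ t ] weights A w k ≡ transitionWeight A t
weights-finite-range A w k =
  transitionOf A (run A w k) (w k) , sym (transitionWeight-of A (run A w k) (w k))

module OptionalIndex {m : ℕ} (f : Fin m → ℚ) where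

  weightOf : Fin (suc m) → Maybe ℚ
  weightOf zero    = nothing
  weightOf (suc i) = just (f i)

  insert : Fin (suc m) → Fin m → Fin (suc m)
  insert zero    t = suc t
  insert (suc i) t with f i Q.≤? f t
  ... | yes _ = suc t
  ... | no  _ = suc i

  weightOf-insert : ∀ e t → weightOf (insert e t) ≡ just (weightOf e ⊔ₘ f t)
  weightOf-insert zero    t = refl
  weightOf-insert (suc i) t with f i Q.≤? f t
  ... | yes fi≤ft = cong just (sym (QP.p≤q⇒p⊔q≡q fi≤ft))
  ... | no  fi≰ft = cong just (sym (QP.p≥q⇒p⊔q≡p (QP.<⇒≤ (QP.≰⇒> fi≰ft))))

  update : ℚ → ℚ → Fin m → Fin (suc m) → Fin (suc m)
  update θ a t e with θ Q.≤? a
  ... | yes _ = zero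
  ... | no  _ = insert e t

  weightOf-update : ∀ θ a t e → weightOf (update θ a t e) ≡ keepBelow θ a (weightOf e ⊔ₘ f t)
  weightOf-update θ a t e with θ Q.≤? a
  ... | yes _ = refl
  ... | no  _ = weightOf-insert e t

suc≤2^ : ∀ n → suc n ≤ 2 ^ n
suc≤2^ zero    = s≤s z≤n
suc≤2^ (suc n) = ℕP.+-mono-≤ (ℕP.^-monoʳ-≤ 2 (z≤n {n})) (ℕP.≤-trans (suc≤2^ n) (ℕP.m≤m+n (2 ^ n) 0))

state-bound : ∀ n₁ n₂ m₁ m₂ → n₁ * (n₂ * suc m₂ ^ m₁) ≤ 1 * (n₁ * n₂ * 2 ^ (m₁ * m₂))
state-bound n₁ n₂ m₁ m₂ = begin
  n₁ * (n₂ * suc m₂ ^ m₁)    ≤⟨ ℕP.*-monoʳ-≤ n₁ (ℕP.*-monoʳ-≤ n₂ (ℕP.^-monoˡ-≤ m₁ (suc≤2^ m₂))) ⟩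
  n₁ * (n₂ * (2 ^ m₂) ^ m₁)  ≡⟨ cong (λ e → n₁ * (n₂ * e)) (ℕP.^-*-assoc 2 m₂ m₁) ⟩
  n₁ * (n₂ * 2 ^ (m₂ * m₁))  ≡⟨ cong (λ e → n₁ * (n₂ * 2 ^ e)) (ℕP.*-comm m₂ m₁) ⟩
  n₁ * (n₂ * 2 ^ (m₁ * m₂))  ≡⟨ sym (ℕP.*-assoc n₁ n₂ _) ⟩
  n₁ * n₂ * 2 ^ (m₁ * m₂)    ≡⟨ sym (ℕP.*-identityˡ _) ⟩
  1 * (n₁ * n₂ * 2 ^ (m₁ * m₂)) ∎
  where open ℕP.≤-Reasoning

-- The sum automaton

module SumAutomaton {s : ℕ} (A₁ A₂ : DetAut s) where

  open OptionalIndex (transitionWeight A₂)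

  -- One memory cell per transition t of A₁, holding an optional transition of A₂.
  Memory : Set
  Memory = Vec (Fin (suc (transitions A₂))) (transitions A₁)

  State : Set
  State = Fin (states A₁) × (Fin (states A₂) × Memory)

  -- Cell t is cleared when A₁ takes a weight ≥ γ₁(t), and otherwise keeps the
  -- largest A₂-weight seen; the output adds γ₁ to the maximum of the cell of
  -- the current A₁-transition and the current A₂-weight.
  sumMachine : Machine s State
  sumMachine = record
    { start = init A₁ , init A₂ , replicate (transitions A₁) zero
    ; next  = λ { (q₁ , q₂ , B) σ →
                δ A₁ q₁ σ , δ A₂ q₂ σ ,
                tabulate (λ t → update (transitionWeight A₁ t) (γ A₁ q₁ σ)
                                       (transitionOf A₂ q₂ σ) (lookup B t)) }
    ; out   = λ { (q₁ , q₂ , B) σ →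
                γ A₁ q₁ σ + (weightOf (lookup B (transitionOf A₁ q₁ σ)) ⊔ₘ γ A₂ q₂ σ) }
    }

  stateCode : Fin (states A₁ * (states A₂ * suc (transitions A₂) ^ transitions A₁)) ↩ State
  stateCode = pairCode (pairCode vecCode)

  sumAutomaton : DetAut s
  sumAutomaton = realise stateCode sumMachine

  module _ (w : Word s) where

    open Window (weights A₁ w) (weights A₂ w)

    trace-control₁ : ∀ n → proj₁ (trace sumMachine w n) ≡ run A₁ w n
    trace-control₁ zero    = refl
    trace-control₁ (suc n) = cong (λ q → δ A₁ q (w n)) (trace-control₁ n)

    trace-control₂ : ∀ n → proj₁ (proj₂ (trace sumMachine w n)) ≡ run A₂ w n
    trace-control₂ zero    = refl
    trace-control₂ (suc n) = cong (λ q → δ A₂ q (w n)) (trace-control₂ n)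

    weight₁ : ∀ n → γ A₁ (proj₁ (trace sumMachine w n)) (w n) ≡ weights A₁ w n
    weight₁ n = cong (λ q → γ A₁ q (w n)) (trace-control₁ n)

    weight₂ : ∀ n → γ A₂ (proj₁ (proj₂ (trace sumMachine w n))) (w n) ≡ weights A₂ w n
    weight₂ n = cong (λ q → γ A₂ q (w n)) (trace-control₂ n)

    trace-memory : ∀ n t → weightOf (lookup (proj₂ (proj₂ (trace sumMachine w n))) t)
                           ≡ runningMax (transitionWeight A₁ t) n
    trace-memory zero    t = cong weightOf (lookup-replicate t zero)
    trace-memory (suc n) t = begin
      weightOf (lookup (tabulate cell) t)
        ≡⟨ cong weightOf (lookup∘tabulate cell t) ⟩
      weightOf (cell t)
        ≡⟨ weightOf-update θ (γ A₁ q₁ σ) (transitionOf A₂ q₂ σ) (lookup B t) ⟩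
      keepBelow θ (γ A₁ q₁ σ) (weightOf (lookup B t) ⊔ₘ transitionWeight A₂ (transitionOf A₂ q₂ σ))
        ≡⟨ cong₂ (keepBelow θ) (weight₁ n)
             (cong₂ _⊔ₘ_ (trace-memory n t) (trans (transitionWeight-of A₂ q₂ σ) (weight₂ n))) ⟩
      runningMax θ (suc n) ∎
      where
      open ≡-Reasoning
      q₁ = proj₁ (trace sumMachine w n)
      q₂ = proj₁ (proj₂ (trace sumMachine w n))
      B  = proj₂ (proj₂ (trace sumMachine w n))
      σ  = w n
      θ  = transitionWeight A₁ t
      cell : Fin (transitions A₁) → Fin (suc (transitions A₂))
      cell t = update (transitionWeight A₁ t) (γ A₁ q₁ σ) (transitionOf A₂ q₂ σ) (lookup B t)

    sumAutomaton-weights : ∀ n → weights sumAutomaton w n ≡ sumSeq n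
    sumAutomaton-weights n = begin
      weights sumAutomaton w n
        ≡⟨ realise-weights stateCode sumMachine w n ⟩
      γ A₁ q₁ σ + (weightOf (lookup B (transitionOf A₁ q₁ σ)) ⊔ₘ γ A₂ q₂ σ)
        ≡⟨ cong₂ _+_ (weight₁ n) (cong₂ _⊔ₘ_ (trace-memory n (transitionOf A₁ q₁ σ)) (weight₂ n)) ⟩
      weights A₁ w n + (runningMax (transitionWeight A₁ (transitionOf A₁ q₁ σ)) n ⊔ₘ weights A₂ w n)
        ≡⟨ cong (λ θ → weights A₁ w n + window θ n) (trans (transitionWeight-of A₁ q₁ σ) (weight₁ n)) ⟩
      sumSeq n ∎
      where
      open ≡-Reasoning
      q₁ = proj₁ (trace sumMachine w n)
      q₂ = proj₁ (proj₂ (trace sumMachine w n))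
      B  = proj₂ (proj₂ (trace sumMachine w n))
      σ  = w n

    -- Correctness: the weight sequence of A₁ is finite-valued, so its limsup
    -- is attained and the window sum has limsup x₁ + x₂.
    sumAutomaton-correct : ∀ x₁ x₂ → LimSupValue A₁ w x₁ → LimSupValue A₂ w x₂ →
                           LimSupValue sumAutomaton w (x₁ + x₂)
    sumAutomaton-correct x₁ x₂ lim₁ lim₂ =
      IsLimSup-cong {x = x₁ + x₂} sumAutomaton-weights
        (sumSeq-limsup {x₁} {x₂}
          (finite-range-attained (transitionWeight A₁) (weights-finite-range A₁ w) lim₁) lim₂)

theorem4p19 :
  ∃[ C ] (∀ {s} (A₁ A₂ : DetAut s) →
    ∃[ A₁₂ ]
      (states A₁₂ ≤ C * (states A₁ * states A₂ * 2 ^ (transitions A₁ * transitions A₂)) ×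
       (∀ (w : Word s) x₁ x₂ → LimSupValue A₁ w x₁ → LimSupValue A₂ w x₂ →
          LimSupValue A₁₂ w (x₁ + x₂))))
theorem4p19 = 1 , λ A₁ A₂ →
  SumAutomaton.sumAutomaton A₁ A₂ ,
  state-bound (states A₁) (states A₂) (transitions A₁) (transitions A₂) ,
  SumAutomaton.sumAutomaton-correct A₁ A₂
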